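{- Let $M\equiv\lambda\mathit{argClass}.\mathbf{Y}(\lambda\mathit{myClass}.\lambda\mathit{state}.(\mathit{argClass}\;\mathit{state})\oplus R)$ be a closed mixin term, where $R$ is a record. For any type $\sigma\in\mathbb{T}$ and any $\rho=\langle l:\tau\rangle$ with $\tau\in\mathbb{T}$ and $l\notin\mathrm{lbl}(R)$, we have $\vdash M:(\sigma\to\rho)\to(\sigma\to\rho)$.
   Context: $\Lambda_R$ terms: $M,N::=x\mid\lambda x.M\mid MN\mid M.l\mid R\mid M\oplus R$, records $R::=\langle l_i=M_i\mid i\in I\rangle$ ($I$ finite, labels pairwise distinct); $\mathrm{lbl}(\langle l_i=M_i\mid i\in I\rangle)=\{l_i\mid i\in I\}$. $\mathbf{Y}=\lambda f.(\lambda x.f(xx))(\lambda x.f(xx))$ (Curry's fixed point combinator); $\mathit{argClass},\mathit{myClass},\mathit{state}$ are term variables. Types $\mathbb{T}$: $\sigma::=a\mid\omega\mid\sigma\to\sigma\mid\sigma\cap\sigma\mid\rho$; record types $\mathbb{T}_R$: $\rho::=\langle\rangle\mid\langle l:\sigma\rangle\mid\rho+\rho\mid\rho\cap\rho$. Subtyping $\le$ is the least preorder with: $\sigma\le\omega$; $\omega\le\omega\to\omega$; $\sigma\cap\tau\le\sigma,\tau$; $\sigma\le\tau_1,\sigma\le\tau_2\Rightarrow\sigma\le\tau_1\cap\tau_2$; $(\sigma\to\tau_1)\cap(\sigma\to\tau_2)\le\sigma\to\tau_1\cap\tau_2$; $\sigma_2\le\sigma_1,\tau_1\le\tau_2\Rightarrow\sigma_1\to\tau_1\le\sigma_2\to\tau_2$;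 $\langle l:\sigma\rangle\le\langle\rangle$; $\langle l:\sigma\rangle\cap\langle l:\tau\rangle\le\langle l:\sigma\cap\tau\rangle$; $\sigma\le\tau\Rightarrow\langle l:\sigma\rangle\le\langle l:\tau\rangle$; with $=$ meaning mutual $\le$: $\rho+\langle\rangle=\langle\rangle+\rho=\rho$; $(\rho_1+\rho_2)+\rho_3=\rho_1+(\rho_2+\rho_3)$; $(\rho_1\cap\rho_2)+\rho_3=(\rho_1+\rho_3)\cap(\rho_2+\rho_3)$; $\langle l:\sigma\rangle+(\langle l:\tau\rangle\cap\rho)=\langle l:\tau\rangle\cap\rho$; $\langle l:\sigma\rangle+(\langle l':\tau\rangle\cap\rho)=\langle l':\tau\rangle\cap(\langle l:\sigma\rangle+\rho)$ if $l\ne l'$; $\rho_1\le\rho_2\Rightarrow\rho_1+\rho\le\rho_2+\rho$; $\rho_1=\rho_2\Rightarrow\rho+\rho_1=\rho+\rho_2$. $\mathrm{lbl}(\langle\rangle)=\emptyset$, $\mathrm{lbl}(\langle l:\sigma\rangle)=\{l\}$, $\mathrm{lbl}(\rho_1\cap\rho_2)=\mathrm{lbl}(\rho_1+\rho_2)=\mathrm{lbl}(\rho_1)\cup\mathrm{lbl}(\rho_2)$. $\vdash M:\tau$ means derivability with empty basis in the system: $x:\sigma\in\Gamma\Rightarrow\Gamma\vdash x:\sigma$; $\to$-intro; $\to$-elim; $\cap$-intro; $\Gamma\vdash M:\omega$; subsumption along $\le$; $\Gamma\vdash\langle l_i=M_i\mid i\in I\rangle:\langle\rangle$; from $\Gamma\vdash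 M_k:\sigma$, $k\in I$ infer $\Gamma\vdash\langle l_i=M_i\mid i\in I\rangle:\langle l_k:\sigma\rangle$; from $\Gamma\vdash M:\langle l:\sigma\rangle$ infer $\Gamma\vdash M.l:\sigma$; from $\Gamma\vdash M:\rho_1$, $\Gamma\vdash R:\rho_2$, $\mathrm{lbl}(R)=\mathrm{lbl}(\rho_2)$ infer $\Gamma\vdash M\oplus R:\rho_1+\rho_2$. -}

module Defs where

open import Data.Nat using (ℕ)
open import Data.Fin using (Fin; zero; suc)
open import Data.Vec using (Vec; _∷_; []; lookup)
open import Data.List using (List; []; _∷_; _++_)
open import Data.List.Membership.Propositional using (_∈_; _∉_)
open import Data.Product using (_×_)
open import Relation.Binary.PropositionalEquality using (_≡_; _≢_)

Label : Set
Label = ℕ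

data Term (n : ℕ) : Set
data Rec (n : ℕ) : Set

data Term n where
  var : Fin n → Term n
  lam : Term (ℕ.suc n) → Term n
  app : Term n → Term n → Term n
  sel : Term n → Label → Term n
  rec : Rec n → Term n
  ext : Term n → Rec n → Term n

data Rec n where
  nil  : Rec n
  cons : Label → Term n → Rec n → Rec n

lbl : ∀ {n} → Rec n → List Label
lbl nil = []
lbl (cons l _ R) = l ∷ lbl R

data _∋_↦_ {n : ℕ} : Rec n → Label → Term n → Set where
  here  : ∀ {l M R} → cons l M R ∋ l ↦ M
  there : ∀ {l M l' M' R} → R ∋ l ↦ M → cons l' M' R ∋ l ↦ M

data WfTerm {n : ℕ} : Term n → Set
data WfRec {n : ℕ} : Rec n → Set

data WfTerm {n} where
  var : ∀ {x} → WfTerm (var x)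
  lam : ∀ {M} → WfTerm M → WfTerm (lam M)
  app : ∀ {M N} → WfTerm M → WfTerm N → WfTerm (app M N)
  sel : ∀ {M l} → WfTerm M → WfTerm (sel M l)
  rec : ∀ {R} → WfRec R → WfTerm (rec R)
  ext : ∀ {M R} → WfTerm M → WfRec R → WfTerm (ext M R)

data WfRec {n} where
  nil  : WfRec nil
  cons : ∀ {l M R} → l ∉ lbl R → WfTerm M → WfRec R → WfRec (cons l M R)

-- Curry's fixed point combinator  Y = λf.(λx.f(xx))(λx.f(xx))
𝐘 : ∀ {n} → Term n
𝐘 = lam (app (lam (app (var (suc zero)) (app (var zero) (var zero))))
             (lam (app (var (suc zero)) (app (var zero) (var zero)))))

-- M ≡ λargClass. Y (λmyClass. λstate. (argClass state) ⊕ R)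
-- Inside R the variables argClass, myClass, state are the de Bruijn
-- indices 2, 1, 0 respectively; M is closed (Term 0).
mixin : Rec 3 → Term 0
mixin R = lam (app 𝐘 (lam (lam (ext (app (var (suc (suc zero))) (var zero)) R))))

-- Types (one raw syntax; 𝕋 and 𝕋_R carved out by predicates)

infixr 7 _⇒_
infixl 8 _∩_
infixl 9 _⊞_

data Ty : Set where
  atom  : ℕ → Ty
  ω     : Ty
  _⇒_   : Ty → Ty → Ty
  _∩_   : Ty → Ty → Ty
  ⟨⟩    : Ty
  ⟨_∶_⟩ : Label → Ty → Ty
  _⊞_   : Ty → Ty → Ty

data IsTy  : Ty → Set
data IsRTy : Ty → Set

data IsTy where
  atom : ∀ {a} → IsTy (atom a)
  ω    : IsTy ω
  _⇒_  : ∀ {σ τ} → IsTy σ → IsTy τ → IsTy (σ ⇒ τ)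
  _∩_  : ∀ {σ τ} → IsTy σ → IsTy τ → IsTy (σ ∩ τ)
  rty  : ∀ {ρ} → IsRTy ρ → IsTy ρ

data IsRTy where
  ⟨⟩    : IsRTy ⟨⟩
  ⟨_∶_⟩ : ∀ {σ} (l : Label) → IsTy σ → IsRTy ⟨ l ∶ σ ⟩
  _⊞_   : ∀ {ρ₁ ρ₂} → IsRTy ρ₁ → IsRTy ρ₂ → IsRTy (ρ₁ ⊞ ρ₂)
  _∩_   : ∀ {ρ₁ ρ₂} → IsRTy ρ₁ → IsRTy ρ₂ → IsRTy (ρ₁ ∩ ρ₂)

lblT : Ty → List Label
lblT ⟨ l ∶ _ ⟩ = l ∷ []
lblT (ρ₁ ∩ ρ₂) = lblT ρ₁ ++ lblT ρ₂
lblT (ρ₁ ⊞ ρ₂) = lblT ρ₁ ++ lblT ρ₂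
lblT _ = []

-- the record-type equations  A = B  (each used in both directions)
data Eqn : Ty → Ty → Set where
  +unitʳ : ∀ {ρ} → IsRTy ρ → Eqn (ρ ⊞ ⟨⟩) ρ
  +unitˡ : ∀ {ρ} → IsRTy ρ → Eqn (⟨⟩ ⊞ ρ) ρ
  +assoc : ∀ {ρ₁ ρ₂ ρ₃} → IsRTy ρ₁ → IsRTy ρ₂ → IsRTy ρ₃ →
           Eqn ((ρ₁ ⊞ ρ₂) ⊞ ρ₃) (ρ₁ ⊞ (ρ₂ ⊞ ρ₃))
  ∩+dist : ∀ {ρ₁ ρ₂ ρ₃} → IsRTy ρ₁ → IsRTy ρ₂ → IsRTy ρ₃ →
           Eqn ((ρ₁ ∩ ρ₂) ⊞ ρ₃) ((ρ₁ ⊞ ρ₃) ∩ (ρ₂ ⊞ ρ₃))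
  +same  : ∀ {l σ τ ρ} → IsTy σ → IsTy τ → IsRTy ρ →
           Eqn (⟨ l ∶ σ ⟩ ⊞ (⟨ l ∶ τ ⟩ ∩ ρ)) (⟨ l ∶ τ ⟩ ∩ ρ)
  +diff  : ∀ {l l' σ τ ρ} → l ≢ l' → IsTy σ → IsTy τ → IsRTy ρ →
           Eqn (⟨ l ∶ σ ⟩ ⊞ (⟨ l' ∶ τ ⟩ ∩ ρ)) (⟨ l' ∶ τ ⟩ ∩ (⟨ l ∶ σ ⟩ ⊞ ρ))

infix 4 _≼_
data _≼_ : Ty → Ty → Set where
  refl    : ∀ {σ} → IsTy σ → σ ≼ σ
  trans   : ∀ {σ τ υ} → σ ≼ τ → τ ≼ υ → σ ≼ υ
  ≤ω      : ∀ {σ} → IsTy σ → σ ≼ ω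
  ω≤ω⇒ω   : ω ≼ ω ⇒ ω
  ∩ˡ      : ∀ {σ τ} → IsTy σ → IsTy τ → σ ∩ τ ≼ σ
  ∩ʳ      : ∀ {σ τ} → IsTy σ → IsTy τ → σ ∩ τ ≼ τ
  ∩I      : ∀ {σ τ₁ τ₂} → σ ≼ τ₁ → σ ≼ τ₂ → σ ≼ τ₁ ∩ τ₂
  ⇒∩      : ∀ {σ τ₁ τ₂} → IsTy σ → IsTy τ₁ → IsTy τ₂ →
            (σ ⇒ τ₁) ∩ (σ ⇒ τ₂) ≼ σ ⇒ (τ₁ ∩ τ₂)
  ⇒mono   : ∀ {σ₁ σ₂ τ₁ τ₂} → σ₂ ≼ σ₁ → τ₁ ≼ τ₂ → σ₁ ⇒ τ₁ ≼ σ₂ ⇒ τ₂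
  fld≤⟨⟩  : ∀ {l σ} → IsTy σ → ⟨ l ∶ σ ⟩ ≼ ⟨⟩
  fld∩    : ∀ {l σ τ} → IsTy σ → IsTy τ → ⟨ l ∶ σ ⟩ ∩ ⟨ l ∶ τ ⟩ ≼ ⟨ l ∶ σ ∩ τ ⟩
  fldmono : ∀ {l σ τ} → σ ≼ τ → ⟨ l ∶ σ ⟩ ≼ ⟨ l ∶ τ ⟩
  eqn→    : ∀ {A B} → Eqn A B → A ≼ B
  eqn←    : ∀ {A B} → Eqn A B → B ≼ A
  +monoˡ  : ∀ {ρ₁ ρ₂ ρ} → IsRTy ρ₁ → IsRTy ρ₂ → IsRTy ρ →
            ρ₁ ≼ ρ₂ → ρ₁ ⊞ ρ ≼ ρ₂ ⊞ ρ
  +congʳ  : ∀ {ρ ρ₁ ρ₂} → IsRTy ρ → IsRTy ρ₁ → IsRTy ρ₂ →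
            ρ₁ ≼ ρ₂ → ρ₂ ≼ ρ₁ → ρ ⊞ ρ₁ ≼ ρ ⊞ ρ₂

_≈ₗ_ : List Label → List Label → Set
xs ≈ₗ ys = ∀ l → (l ∈ xs → l ∈ ys) × (l ∈ ys → l ∈ xs)

Ctx : ℕ → Set
Ctx n = Vec Ty n

infix 3 _⊢_∶_
data _⊢_∶_ {n : ℕ} (Γ : Ctx n) : Term n → Ty → Set where
  var   : ∀ x → Γ ⊢ var x ∶ lookup Γ x
  ⇒I    : ∀ {M σ τ} → IsTy σ → (σ ∷ Γ) ⊢ M ∶ τ → Γ ⊢ lam M ∶ σ ⇒ τ
  ⇒E    : ∀ {M N σ τ} → Γ ⊢ M ∶ σ ⇒ τ → Γ ⊢ N ∶ σ → Γ ⊢ app M N ∶ τ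
  ∩I    : ∀ {M σ τ} → Γ ⊢ M ∶ σ → Γ ⊢ M ∶ τ → Γ ⊢ M ∶ σ ∩ τ
  ωI    : ∀ {M} → Γ ⊢ M ∶ ω
  sub   : ∀ {M σ τ} → Γ ⊢ M ∶ σ → σ ≼ τ → Γ ⊢ M ∶ τ
  rec⟨⟩ : ∀ {R} → Γ ⊢ rec R ∶ ⟨⟩
  recI  : ∀ {R l M σ} → R ∋ l ↦ M → Γ ⊢ M ∶ σ → Γ ⊢ rec R ∶ ⟨ l ∶ σ ⟩
  selE  : ∀ {M l σ} → Γ ⊢ M ∶ ⟨ l ∶ σ ⟩ → Γ ⊢ sel M l ∶ σ
  extI  : ∀ {M R ρ₁ ρ₂} → IsRTy ρ₁ → IsRTy ρ₂ →
          Γ ⊢ M ∶ ρ₁ → Γ ⊢ rec R ∶ ρ₂ → lbl R ≈ₗ lblT ρ₂ →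
          Γ ⊢ ext M R ∶ ρ₁ ⊞ ρ₂

infix 3 ⊢₀_∶_
⊢₀_∶_ : Term 0 → Ty → Set
⊢₀ M ∶ σ = [] ⊢ M ∶ σ

-- Give R the type ⋂ᵢ ⟨lᵢ : ω⟩, which only records its labels: extending a
-- field ⟨l : τ⟩ by it pushes ⟨l : τ⟩ past every ⟨lᵢ : ω⟩ (as l ≠ lᵢ) and
-- leaves ⟨l : τ⟩. So the body λ myClass. λ state. (argClass state) ⊕ R has type
-- ω → σ → ⟨l : τ⟩ when argClass : σ → ⟨l : τ⟩, and Y maps any ω → T to T,
-- since its self-application x x is only ever typed by ω.
module Submission where

open import Defs
open import Data.Fin using (zero; suc)
open import Data.List using (List; _∷_)
open import Data.List.Membership.Propositional using (_∉_)
open import Data.List.Relation.Unary.Any using (here; there)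
open import Data.Vec using (_∷_; [])
open import Data.Product using (_,_)
open import Function using (id)
open import Relation.Binary.PropositionalEquality using (_≡_; refl; sym; cong)

ωFields : ∀ {n} → Rec n → Ty
ωFields nil = ⟨⟩
ωFields (cons l _ R) = ⟨ l ∶ ω ⟩ ∩ ωFields R

isRTy-ωFields : ∀ {n} (R : Rec n) → IsRTy (ωFields R)
isRTy-ωFields nil = ⟨⟩
isRTy-ωFields (cons l _ R) = ⟨ l ∶ ω ⟩ ∩ isRTy-ωFields R

lblT-ωFields : ∀ {n} (R : Rec n) → lblT (ωFields R) ≡ lbl R
lblT-ωFields nil = refl
lblT-ωFields (cons l _ R) = cong (l ∷_) (lblT-ωFields R)

≈ₗ-reflexive : {xs ys : List Label} → xs ≡ ys → xs ≈ₗ ys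
≈ₗ-reflexive refl _ = id , id

rec-⊢-ωFields : ∀ {n} {Γ : Ctx n} (R S : Rec n) →
                (∀ {l M} → S ∋ l ↦ M → R ∋ l ↦ M) → Γ ⊢ rec R ∶ ωFields S
rec-⊢-ωFields R nil S⊆R = rec⟨⟩
rec-⊢-ωFields R (cons l M S) S⊆R =
  ∩I (recI (S⊆R here) ωI) (rec-⊢-ωFields R S (λ p → S⊆R (there p)))

⊞ωFields-≼ : ∀ {n} {l : Label} {τ : Ty} → IsTy τ → (R : Rec n) → l ∉ lbl R →
             ⟨ l ∶ τ ⟩ ⊞ ωFields R ≼ ⟨ l ∶ τ ⟩
⊞ωFields-≼ iτ nil l∉R = eqn→ (+unitʳ ⟨ _ ∶ iτ ⟩)
⊞ωFields-≼ {l = l} iτ (cons l′ _ R) l∉R =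
  trans (eqn→ (+diff (λ l≡l′ → l∉R (here l≡l′)) iτ ω (isRTy-ωFields R)))
        (trans (∩ʳ (rty ⟨ l′ ∶ ω ⟩) (rty (⟨ l ∶ iτ ⟩ ⊞ isRTy-ωFields R)))
               (⊞ωFields-≼ iτ R (λ l∈R → l∉R (there l∈R))))

ext-⊢-field : ∀ {n} {Γ : Ctx n} {M : Term n} {l : Label} {τ : Ty} → IsTy τ →
              (R : Rec n) → l ∉ lbl R →
              Γ ⊢ M ∶ ⟨ l ∶ τ ⟩ → Γ ⊢ ext M R ∶ ⟨ l ∶ τ ⟩
ext-⊢-field iτ R l∉R ⊢M =
  sub (extI ⟨ _ ∶ iτ ⟩ (isRTy-ωFields R) ⊢M (rec-⊢-ωFields R R id)
            (≈ₗ-reflexive (sym (lblT-ωFields R))))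
      (⊞ωFields-≼ iτ R l∉R)

𝐘-⊢ : ∀ {n} {Γ : Ctx n} {T : Ty} → IsTy T → Γ ⊢ 𝐘 ∶ (ω ⇒ T) ⇒ T
𝐘-⊢ iT = ⇒I (ω ⇒ iT) (⇒E (⇒I ω (⇒E (var (suc zero)) ωI)) ωI)

lemma3p19 : (R : Rec 3) → WfRec R → (σ τ : Ty) → IsTy σ → IsTy τ →
            (l : Label) → l ∉ lbl R →
            ⊢₀ mixin R ∶ (σ ⇒ ⟨ l ∶ τ ⟩) ⇒ (σ ⇒ ⟨ l ∶ τ ⟩)
lemma3p19 R _ σ τ iσ iτ l l∉R =
  ⇒I σ⇒ρ (⇒E (𝐘-⊢ σ⇒ρ) (⇒I ω (⇒I iσ (ext-⊢-field iτ R l∉R argClass-state))))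
  where
  σ⇒ρ : IsTy (σ ⇒ ⟨ l ∶ τ ⟩)
  σ⇒ρ = iσ ⇒ rty ⟨ l ∶ iτ ⟩

  argClass-state : σ ∷ ω ∷ (σ ⇒ ⟨ l ∶ τ ⟩) ∷ [] ⊢ app (var (suc (suc zero))) (var zero) ∶ ⟨ l ∶ τ ⟩
  argClass-state = ⇒E (var (suc (suc zero))) (var zero)
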